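{- If $(\mathcal{C},\mathcal{K})$ is a proximity domain, then every system of islands corresponding to $(\mathcal{C},\mathcal{K})$ is a distant family.
   Context: An island domain is a pair $(\mathcal{C},\mathcal{K})$ where $U$ is a nonempty finite set and $\mathcal{C}\subseteq\mathcal{K}\subseteq\mathcal{P}(U)$ with $U\in\mathcal{C}$. It is connective if for all $A,B\in\mathcal{C}$ with $A\cap B\neq\emptyset$ and $B\not\subseteq A$ there exists $K\in\mathcal{K}$ with $A\subsetneq K\subseteq A\cup B$. Let $\prec$ denote the cover relation of $(\mathcal{K},\subseteq)$ and write $A\preceq K$ if $A\prec K$ or $A=K$. Define $\delta$ on $\mathcal{C}$ by $A\,\delta\,B$ iff there is $K\in\mathcal{K}$ with $A\preceq K$ and $K\cap B\neq\emptyset$. A proximity domain is a connective island domain such that for all nonempty $A,B\in\mathcal{C}$, $A\,\delta\,B\iff B\,\delta\,A$. $A,B\in\mathcal{C}$ are distant if neither $A\,\delta\,B$ nor $B\,\delta\,A$; a nonempty family $\mathcal{H}\subseteq\mathcal{C}$ is distant if any two incomparable members of it are distant. A height function is any map $h\colon U\to\mathbb{R}$. A nonempty $S\in\mathcal{C}$ is an island with respect to $(\mathcal{C},\mathcal{K},h)$ if for every $K\in\mathcal{K}$ with $S\prec K$ and every $u\in K\setminus S$ we have $h(u)<\min h(S)$. A system of islands corresponding to $(\mathcal{C},\mathcal{K})$ is a family that equals, for some height function $h$, the set of all nonempty $S\in\mathcal{C}$ that are islands with respect to $(\mathcal{C},\mathcal{K},h)$. -}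

module Defs where

open import Level using (Level; _⊔_; 0ℓ)
open import Data.Nat using (ℕ; suc)
open import Data.Fin using (Fin)
open import Data.Fin.Subset using (Subset; _∈_; _⊆_; _⊂_; _∩_; _∪_; ⊤; Nonempty)
open import Data.Product using (Σ; _×_; ∃; ∃-syntax)
open import Data.Sum using (_⊎_)
open import Relation.Nullary using (¬_)
open import Relation.Unary using (Pred)
open import Relation.Binary.PropositionalEquality using (_≡_)
open import Relation.Binary.Bundles using (StrictTotalOrder)
open import Function.Bundles using (_⇔_)

-- The universe U is Fin n; families of subsets of U are predicates on Subset n.
Family : ℕ → Set₁
Family n = Pred (Subset n) 0ℓ

module _ {n : ℕ} where

  -- (C, K) is an island domain: C ⊆ K and U ∈ C  (U = ⊤, nonempty since n = suc m below)
  IsIslandDomain : Family n → Family n → Set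
  IsIslandDomain 𝒞 𝒦 = (∀ A → 𝒞 A → 𝒦 A) × 𝒞 ⊤

  IsConnective : Family n → Family n → Set
  IsConnective 𝒞 𝒦 =
    ∀ A B → 𝒞 A → 𝒞 B → Nonempty (A ∩ B) → ¬ (B ⊆ A) →
    ∃[ K ] (𝒦 K × A ⊂ K × K ⊆ A ∪ B)

  Covers : Family n → Subset n → Subset n → Set
  Covers 𝒦 A K = 𝒦 A × 𝒦 K × A ⊂ K × (∀ L → 𝒦 L → A ⊂ L → ¬ (L ⊂ K))

  CoversOrEq : Family n → Subset n → Subset n → Set
  CoversOrEq 𝒦 A K = Covers 𝒦 A K ⊎ A ≡ K

  δ : Family n → Subset n → Subset n → Set
  δ 𝒦 A B = ∃[ K ] (𝒦 K × CoversOrEq 𝒦 A K × Nonempty (K ∩ B))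

  IsProximityDomain : Family n → Family n → Set
  IsProximityDomain 𝒞 𝒦 =
    IsIslandDomain 𝒞 𝒦 × IsConnective 𝒞 𝒦 ×
    (∀ A B → 𝒞 A → 𝒞 B → Nonempty A → Nonempty B → (δ 𝒦 A B ⇔ δ 𝒦 B A))

  Distant : Family n → Subset n → Subset n → Set
  Distant 𝒦 A B = ¬ δ 𝒦 A B × ¬ δ 𝒦 B A

  IsDistantFamily : Family n → Family n → Family n → Set
  IsDistantFamily 𝒞 𝒦 ℋ =
    (∀ A → ℋ A → 𝒞 A) × (∃[ A ] ℋ A) ×
    (∀ A B → ℋ A → ℋ B → ¬ (A ⊆ B) → ¬ (B ⊆ A) → Distant 𝒦 A B)

  module _ {c ℓ₁ ℓ₂ : Level} (O : StrictTotalOrder c ℓ₁ ℓ₂) where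
    open StrictTotalOrder O renaming (Carrier to H)

    -- S is an island w.r.t. (C, K, h); "h(u) < min h(S)" is written as
    -- "h(u) < h(s) for all s ∈ S" (S is nonempty, so these agree).
    IsIsland : Family n → Family n → (Fin n → H) → Subset n → Set ℓ₂
    IsIsland 𝒞 𝒦 h S =
      Nonempty S × 𝒞 S ×
      (∀ K → Covers 𝒦 S K → ∀ u → u ∈ K → ¬ (u ∈ S) → ∀ s → s ∈ S → h u < h s)

    IsSystemOfIslands : Family n → Family n → Family n → Set (c ⊔ ℓ₂)
    IsSystemOfIslands 𝒞 𝒦 ℐ =
      ∃[ h ] (∀ S → (ℐ S ⇔ IsIsland 𝒞 𝒦 h S))

module Submission where

-- Say that B dips below A (for a height h) when some point of B
-- is lower than every point of A.  Let A be an island and B ∈ 𝒞 with B ⊄ A.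
-- If A δ B, then B dips below A: a witness x ∈ K ∩ B with A ⪯ K either lies
-- outside A, so K covers A and x is lower than A by the island condition;
-- or it lies in A ∩ B, and connectivity gives K' ∈ 𝒦 with A ⊂ K' ⊆ A ∪ B.
-- Since the universe is finite, K' contains a cover L of A, and any point of
-- L ∖ A lies in B and is lower than A.  For two incomparable islands A, B,
-- the symmetry of δ in a proximity domain turns A δ B into B δ A as well, so
-- each dips below the other, which is impossible in a strict order.
--
-- Since 𝒦 is an arbitrary predicate, the
-- existence statements are only established up to double negation, which
-- suffices because every conclusion we draw from them is a negation.

open import Defs
open import Level using (Level)
open import Data.Nat using (ℕ; suc)
open import Relation.Binary.Bundles using (StrictTotalOrder)
open import Data.Fin using (Fin)
open import Data.Fin.Subset using (Subset; _∈_; _∉_; _⊆_; _⊂_; _∩_; ⊤; Nonempty)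
open import Data.Fin.Subset.Properties
  using (_∈?_; ∈⊤; ⊆-refl; ⊆-trans; x∈p∩q⁻; x∈p∩q⁺; x∈p∪q⁻)
open import Data.Fin.Subset.Induction using (⊂-wellFounded)
open import Induction.WellFounded using (Acc; acc)
open import Data.Product using (_×_; ∃-syntax; _,_; proj₁; proj₂)
open import Data.Sum using (inj₁; inj₂)
open import Data.Empty using (⊥; ⊥-elim)
open import Relation.Nullary using (¬_; yes; no)
open import Relation.Binary.PropositionalEquality using (refl)
open import Function.Bundles using (Equivalence)

module _ {n : ℕ} {𝒦 : Family n} {A : Subset n} (kA : 𝒦 A) where

  cover-below-acc : ∀ K → Acc _⊂_ K → 𝒦 K → A ⊂ K →
                    ¬ ¬ (∃[ L ] (Covers 𝒦 A L × L ⊆ K))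
  cover-below-acc K (acc smaller) kK A⊂K noCover =
    noCover (K , (kA , kK , A⊂K , minimal) , ⊆-refl)
    where
    -- K is minimal over A: a cover inside a smaller extension L would lie inside K
    minimal : ∀ L → 𝒦 L → A ⊂ L → ¬ (L ⊂ K)
    minimal L kL A⊂L L⊂K =
      cover-below-acc L (smaller L⊂K) kL A⊂L
        (λ (M , cover , M⊆L) → noCover (M , cover , ⊆-trans M⊆L (proj₁ L⊂K)))

  cover-below : ∀ K → 𝒦 K → A ⊂ K → ¬ ¬ (∃[ L ] (Covers 𝒦 A L × L ⊆ K))
  cover-below K = cover-below-acc K (⊂-wellFounded K)

module _ {c ℓ₁ ℓ₂ : Level} (O : StrictTotalOrder c ℓ₁ ℓ₂) where
  open StrictTotalOrder O renaming (Carrier to Height)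

  module _ {n : ℕ} {𝒞 𝒦 : Family n} (h : Fin n → Height) where

    DipsBelow : Subset n → Subset n → Set ℓ₂
    DipsBelow A B = ∃[ x ] (x ∈ B × ∀ a → a ∈ A → h x < h a)

    dips-asymmetric : ∀ {A B} → DipsBelow A B → ¬ DipsBelow B A
    dips-asymmetric (x , x∈B , x<A) (y , y∈A , y<B) =
      irrefl Eq.refl (trans (x<A y y∈A) (y<B x x∈B))

    exit-dips : ∀ {A B K} → IsIsland O 𝒞 𝒦 h A → Covers 𝒦 A K →
                ∀ {u} → u ∈ K → u ∉ A → u ∈ B → DipsBelow A B
    exit-dips (_ , _ , low) cover u∈K u∉A u∈B = _ , u∈B , low _ cover _ u∈K u∉A

    overlap-dips : (∀ S → 𝒞 S → 𝒦 S) → IsConnective 𝒞 𝒦 →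
                   ∀ {A B} → IsIsland O 𝒞 𝒦 h A → 𝒞 B →
                   Nonempty (A ∩ B) → ¬ (B ⊆ A) → ¬ ¬ DipsBelow A B
    overlap-dips 𝒞⊆𝒦 connective {A} {B} isA@(_ , cA , _) cB A∩B≠∅ B⊈A noDip
      with connective A B cA cB A∩B≠∅ B⊈A
    ... | K' , kK' , A⊂K' , K'⊆A∪B =
      cover-below (𝒞⊆𝒦 A cA) K' kK' A⊂K' λ (L , cover , L⊆K') → exits L cover L⊆K'
      where
      exits : ∀ L → Covers 𝒦 A L → L ⊆ K' → ⊥
      exits L cover@(_ , _ , (_ , u , u∈L , u∉A) , _) L⊆K'
        with x∈p∪q⁻ A B (K'⊆A∪B (L⊆K' u∈L))
      ... | inj₁ u∈A = u∉A u∈A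
      ... | inj₂ u∈B = noDip (exit-dips isA cover u∈L u∉A u∈B)

    δ-dips : (∀ S → 𝒞 S → 𝒦 S) → IsConnective 𝒞 𝒦 →
             ∀ {A B} → IsIsland O 𝒞 𝒦 h A → 𝒞 B → ¬ (B ⊆ A) →
             δ 𝒦 A B → ¬ ¬ DipsBelow A B
    δ-dips 𝒞⊆𝒦 connective {A} {B} isA cB B⊈A (K , _ , A⪯K , x , x∈K∩B)
      with x∈p∩q⁻ K B x∈K∩B | x ∈? A
    ... | x∈K , x∈B | yes x∈A =
      overlap-dips 𝒞⊆𝒦 connective isA cB (x , x∈p∩q⁺ (x∈A , x∈B)) B⊈A
    ... | x∈K , x∈B | no x∉A with A⪯K
    ...   | inj₁ cover = λ noDip → noDip (exit-dips isA cover x∈K x∉A x∈B)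
    ...   | inj₂ refl = ⊥-elim (x∉A x∈K)

    islands-not-δ : IsProximityDomain 𝒞 𝒦 →
                    ∀ {A B} → IsIsland O 𝒞 𝒦 h A → IsIsland O 𝒞 𝒦 h B →
                    ¬ (A ⊆ B) → ¬ (B ⊆ A) → ¬ δ 𝒦 A B
    islands-not-δ ((𝒞⊆𝒦 , _) , connective , symmetric) {A} {B}
                  isA@(neA , cA , _) isB@(neB , cB , _) A⊈B B⊈A AδB =
      δ-dips 𝒞⊆𝒦 connective isA cB B⊈A AδB λ BdipsA →
      δ-dips 𝒞⊆𝒦 connective isB cA A⊈B BδA λ AdipsB →
      dips-asymmetric BdipsA AdipsB
      where
      BδA : δ 𝒦 B A
      BδA = Equivalence.to (symmetric A B cA cB neA neB) AδB

    ⊤-isIsland : Nonempty (⊤ {n}) → 𝒞 ⊤ → IsIsland O 𝒞 𝒦 h ⊤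
    ⊤-isIsland ne c⊤ = ne , c⊤ , λ _ _ _ _ u∉⊤ → ⊥-elim (u∉⊤ ∈⊤)

proposition5p8 : {c ℓ₁ ℓ₂ : Level} (O : StrictTotalOrder c ℓ₁ ℓ₂) →
    (m : ℕ) (𝒞 𝒦 : Family (suc m)) → IsProximityDomain 𝒞 𝒦 →
    (ℐ : Family (suc m)) → IsSystemOfIslands O 𝒞 𝒦 ℐ → IsDistantFamily 𝒞 𝒦 ℐ
proposition5p8 O m 𝒞 𝒦 proximity@((_ , c⊤) , _) ℐ (h , islands) =
  inℐ⇒in𝒞 , (⊤ , ⊤∈ℐ) , distant
  where
  open Equivalence
  inℐ⇒in𝒞 : ∀ S → ℐ S → 𝒞 S
  inℐ⇒in𝒞 S iS = proj₁ (proj₂ (to (islands S) iS))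

  ⊤∈ℐ : ℐ ⊤
  ⊤∈ℐ = from (islands ⊤) (⊤-isIsland O {𝒞 = 𝒞} {𝒦 = 𝒦} h (Fin.zero , ∈⊤) c⊤)

  distant : ∀ A B → ℐ A → ℐ B → ¬ (A ⊆ B) → ¬ (B ⊆ A) → Distant 𝒦 A B
  distant A B iA iB A⊈B B⊈A =
    islands-not-δ O h proximity isA isB A⊈B B⊈A ,
    islands-not-δ O h proximity isB isA B⊈A A⊈B
    where
    isA : IsIsland O 𝒞 𝒦 h A
    isA = to (islands A) iA
    isB : IsIsland O 𝒞 𝒦 h B
    isB = to (islands B) iB
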